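{- Let $\varphi(\vec{x},\vec{y})$ be a generalized $P$-encoding on $n$ input variables in regular form, let $\psi=\varphi\setminus\bigcup_{k\in[n]}Q_{\varphi,k}$, and let $i,j\in[n]$ be distinct with $L_{\varphi,i}=\{\ell_{i,1},\ell_{i,2}\}$ and $L_{\varphi,j}=\{\ell_{j,1},\ell_{j,2}\}$. Then $\psi|_{\tau_i}\wedge\ell_{i,1}\wedge\ell_{i,2}\wedge\ell_{j,1}\wedge\ell_{j,2}$ is unsatisfiable.
   Context: A CNF formula is a set of clauses (sets of literals). For a partial assignment $\tau$, $\varphi|_\tau$ deletes clauses satisfied by $\tau$ and deletes literals falsified by $\tau$ from the remaining clauses. Let $\vec{x}=(x_1,\dots,x_n)$ be input variables and $\vec{y}$ a finite set of auxiliary variables. A CNF $\varphi(\vec{x},\vec{y})$ is a generalized $P$-encoding on $n$ input variables if (a) $\varphi\wedge x_i$ is satisfiable for each $i$, and (b) $\varphi\models\overline{x_i}\vee\overline{x_j}$ for all distinct $i,j$. $Q_{\varphi,i}$ is the set of clauses of $\varphi$ containing $\overline{x_i}$, and $L_{\varphi,i}=\{e : (\overline{x_i}\vee e)\in\varphi\}$. $\varphi$ is in regular form if for each $i$: $|Q_{\varphi,i}|=2$, $x_i$ is the only input variable in the clauses of $Q_{\varphi,i}$, and each clause of $Q_{\varphi,i}$ has exactly two literals. $\tau_i$ is the assignment of $\vec{x}$ with $x_i=\top$ and $x_k=\bot$ for $k\ne i$. -}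

module Defs where

open import Data.Nat using (ℕ)
open import Data.Fin using (Fin; _≟_)
open import Data.Sum using (_⊎_; inj₁; inj₂)
open import Data.Product using (Σ; ∃; _×_; _,_)
open import Data.Bool using (Bool; true; false; not; _∧_; _∨_; if_then_else_)
open import Data.Maybe using (Maybe; just; nothing)
open import Data.List using (List; []; _∷_; _++_; map; filterᵇ)
open import Data.Bool.ListAction using (any)
open import Data.List.Relation.Unary.All using (All)
open import Data.List.Relation.Unary.Any using (Any)
open import Data.List.Membership.Propositional using (_∈_)
open import Relation.Binary.PropositionalEquality using (_≡_)
open import Relation.Nullary using (¬_; does)
open import Function.Bundles using (_⇔_)

-- Variables: n input variables x_k (inj₁ k) and m auxiliary variables y_k (inj₂ k).
Var : ℕ → ℕ → Set
Var n m = Fin n ⊎ Fin m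

data Lit (n m : ℕ) : Set where
  pos : Var n m → Lit n m
  neg : Var n m → Lit n m

litVar : ∀ {n m} → Lit n m → Var n m
litVar (pos v) = v
litVar (neg v) = v

-- Clauses and CNFs are lists, read as sets (all notions below are set-invariant).
Clause : ℕ → ℕ → Set
Clause n m = List (Lit n m)

CNF : ℕ → ℕ → Set
CNF n m = List (Clause n m)

x : ∀ {n m} → Fin n → Lit n m
x k = pos (inj₁ k)

x̄ : ∀ {n m} → Fin n → Lit n m
x̄ k = neg (inj₁ k)

Assignment : ℕ → ℕ → Set
Assignment n m = Var n m → Bool

evalLit : ∀ {n m} → Assignment n m → Lit n m → Bool
evalLit α (pos v) = α v
evalLit α (neg v) = not (α v)

SatClause : ∀ {n m} → Assignment n m → Clause n m → Set
SatClause α C = Any (λ l → evalLit α l ≡ true) C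

SatCNF : ∀ {n m} → Assignment n m → CNF n m → Set
SatCNF α φ = All (SatClause α) φ

Satisfiable : ∀ {n m} → CNF n m → Set
Satisfiable {n} {m} φ = Σ (Assignment n m) (λ α → SatCNF α φ)

Entails : ∀ {n m} → CNF n m → Clause n m → Set
Entails {n} {m} φ C = (α : Assignment n m) → SatCNF α φ → SatClause α C

PartialAssignment : ℕ → ℕ → Set
PartialAssignment n m = Var n m → Maybe Bool

litVal : ∀ {n m} → PartialAssignment n m → Lit n m → Maybe Bool
litVal τ (pos v) = τ v
litVal τ (neg v) with τ v
... | just b = just (not b)
... | nothing = nothing

isTrue : Maybe Bool → Bool
isTrue (just true) = true
isTrue _ = false

isFalse : Maybe Bool → Bool
isFalse (just false) = true
isFalse _ = false

satisfiedBy : ∀ {n m} → PartialAssignment n m → Clause n m → Bool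
satisfiedBy τ C = any (λ l → isTrue (litVal τ l)) C

restrict : ∀ {n m} → CNF n m → PartialAssignment n m → CNF n m
restrict φ τ = map (filterᵇ (λ l → not (isFalse (litVal τ l))))
                   (filterᵇ (λ C → not (satisfiedBy τ C)) φ)

τ : ∀ {n m} → Fin n → PartialAssignment n m
τ i (inj₁ k) = just (does (k ≟ i))
τ i (inj₂ _) = nothing

record GenPEncoding {n m : ℕ} (φ : CNF n m) : Set where
  field
    sat-xi : (i : Fin n) → Satisfiable (φ ++ ((x i ∷ []) ∷ []))
    amo    : (i j : Fin n) → ¬ (i ≡ j) → Entails φ (x̄ i ∷ x̄ j ∷ [])

SameSet : ∀ {n m} → Clause n m → Clause n m → Set
SameSet C D = ∀ l → (l ∈ C) ⇔ (l ∈ D)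

isX̄ : ∀ {n m} → Fin n → Lit n m → Bool
isX̄ i (neg (inj₁ k)) = does (k ≟ i)
isX̄ i _ = false

Q : ∀ {n m} → CNF n m → Fin n → CNF n m
Q φ i = filterᵇ (λ C → any (isX̄ i) C) φ

HasTwoClauses : ∀ {n m} → CNF n m → Set
HasTwoClauses {n} {m} Qs =
  Σ (Clause n m) λ C → Σ (Clause n m) λ D →
    ¬ SameSet C D × C ∈ Qs × D ∈ Qs ×
    ((E : Clause n m) → E ∈ Qs → SameSet E C ⊎ SameSet E D)

HasTwoLits : ∀ {n m} → Clause n m → Set
HasTwoLits {n} {m} C =
  Σ (Lit n m) λ a → Σ (Lit n m) λ b → ¬ (a ≡ b) ×
    ((l : Lit n m) → (l ∈ C) ⇔ (l ≡ a ⊎ l ≡ b))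

OnlyInput : ∀ {n m} → Fin n → Clause n m → Set
OnlyInput {n} i C = (l : _) → l ∈ C → (k : Fin n) → litVar l ≡ inj₁ k → k ≡ i

RegularForm : ∀ {n m} → CNF n m → Set
RegularForm {n} φ = (i : Fin n) →
  HasTwoClauses (Q φ i) ×
  ((C : _) → C ∈ Q φ i → OnlyInput i C × HasTwoLits C)

InL : ∀ {n m} → CNF n m → Fin n → Lit n m → Set
InL φ i e = ∃ λ C → C ∈ φ × SameSet C (x̄ i ∷ e ∷ [])

isNegInput : ∀ {n m} → Lit n m → Bool
isNegInput (neg (inj₁ _)) = true
isNegInput _ = false

-- ψ = φ \ ⋃_k Q_{φ,k}
removeQ : ∀ {n m} → CNF n m → CNF n m
removeQ φ = filterᵇ (λ C → not (any isNegInput C)) φ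

{-# OPTIONS --safe #-}
module Submission where

-- From a model α of ψ|τ_i in which the literals of L_{φ,i} and L_{φ,j} are
-- true, build the assignment β that sets x_i and x_j to ⊤, every other input
-- to ⊥, and agrees with α on the auxiliaries.  The clauses of ψ hold under
-- τ_i completed by α, and contain no negated input, so they survive raising
-- x_j.  By regularity a clause of Q_{φ,i} or Q_{φ,j} is x̄ ∨ e with e ∈ L and
-- e either auxiliary or the input itself, so it holds; every other clause
-- contains some x̄_k with β(x_k) = ⊥.  Thus β ⊨ φ while β falsifies
-- x̄_i ∨ x̄_j, contradicting φ ⊨ x̄_i ∨ x̄_j.

open import Defs
open import Data.Nat using (ℕ)
open import Data.Fin using (Fin; _≟_)
open import Data.Sum using (_⊎_; inj₁; inj₂; swap)
open import Data.Product using (∃; _×_; _,_; proj₂)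
open import Data.Bool using (true; false; not; _∨_; T; T?)
open import Data.Bool.Properties using (T-≡; T-not-≡; ∨-zeroʳ; not-¬)
open import Data.Bool.ListAction using (any)
open import Data.Maybe using (just; nothing; fromMaybe)
open import Data.List using ([]; _∷_; _++_; filterᵇ)
open import Data.List.Relation.Unary.All using ([]; _∷_; lookup; tabulate)
open import Data.List.Relation.Unary.All.Properties using (++⁻; All¬⇒¬Any)
open import Data.List.Relation.Unary.Any as Any using (here; there)
open import Data.List.Relation.Unary.Any.Properties using (any⁺; any⁻; singleton⁻)
open import Data.List.Membership.Propositional using (_∈_; find; lose)
open import Data.List.Membership.Propositional.Properties using (∈-filter⁺; ∈-filter⁻)
open import Data.Empty using (⊥-elim)
open import Function using (_∘_)
open import Function.Bundles using (_⇔_; mk⇔; Equivalence)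
import Function.Properties.Equivalence as ⇔
open import Relation.Binary.PropositionalEquality
  using (_≡_; _≢_; refl; sym; trans; cong; cong₂; subst)
open import Relation.Nullary using (¬_; does; yes; no)
open import Relation.Nullary.Decidable using (dec-true; dec-false)

private
  variable
    n m : ℕ
    i j k : Fin n
    l : Lit n m
    C : Clause n m
    φ : CNF n m
    α β γ : Assignment n m

AgreeOnAux : Assignment n m → Assignment n m → Set
AgreeOnAux α β = ∀ y → α (inj₂ y) ≡ β (inj₂ y)

InputsRaised : Assignment n m → Assignment n m → Set
InputsRaised γ β = ∀ k → γ (inj₁ k) ≡ true → β (inj₁ k) ≡ true

_⊕_ : PartialAssignment n m → Assignment n m → Assignment n m
(ρ ⊕ α) v = fromMaybe (α v) (ρ v)

evalLit-⊕ : (ρ : PartialAssignment n m) (α : Assignment n m) (l : Lit n m) →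
            evalLit (ρ ⊕ α) l ≡ fromMaybe (evalLit α l) (litVal ρ l)
evalLit-⊕ ρ α (pos v) = refl
evalLit-⊕ ρ α (neg v) with ρ v
... | just b  = refl
... | nothing = refl

evalLit-⊕-true : (ρ : PartialAssignment n m) (α : Assignment n m) (l : Lit n m) →
         T (isTrue (litVal ρ l)) → evalLit (ρ ⊕ α) l ≡ true
evalLit-⊕-true ρ α l t rewrite evalLit-⊕ ρ α l with litVal ρ l
... | just true = refl

evalLit-⊕-unfalsified : (ρ : PartialAssignment n m) (α : Assignment n m) (l : Lit n m) →
                T (not (isFalse (litVal ρ l))) → evalLit α l ≡ true →
                evalLit (ρ ⊕ α) l ≡ true
evalLit-⊕-unfalsified ρ α l t αl rewrite evalLit-⊕ ρ α l with litVal ρ l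
... | just true = refl
... | nothing   = αl

satisfiedBy⇒SatClause : (ρ : PartialAssignment n m) (α : Assignment n m) (C : Clause n m) →
                        T (satisfiedBy ρ C) → SatClause (ρ ⊕ α) C
satisfiedBy⇒SatClause ρ α C t = Any.map (λ {l} → evalLit-⊕-true ρ α l) (any⁻ _ C t)

remnant⇒SatClause : (ρ : PartialAssignment n m) →
                    SatClause α (filterᵇ (λ l → not (isFalse (litVal ρ l))) C) →
                    SatClause (ρ ⊕ α) C
remnant⇒SatClause {α = α} ρ s with find s
... | l , l∈ , αl with ∈-filter⁻ (T? ∘ λ l → not (isFalse (litVal ρ l))) l∈
...   | l∈C , t = lose l∈C (evalLit-⊕-unfalsified ρ α l t αl)

SatCNF-restrict : (φ : CNF n m) (ρ : PartialAssignment n m) →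
                  SatCNF α (restrict φ ρ) → SatCNF (ρ ⊕ α) φ
SatCNF-restrict [] ρ _ = []
SatCNF-restrict {α = α} (C ∷ φ) ρ s with satisfiedBy ρ C in satC
... | true  =
  satisfiedBy⇒SatClause ρ α C (Equivalence.from T-≡ satC) ∷ SatCNF-restrict φ ρ s
... | false with s
...   | sC ∷ sφ = remnant⇒SatClause ρ sC ∷ SatCNF-restrict φ ρ sφ

evalLit-positive-mono : InputsRaised γ β → AgreeOnAux γ β → (l : Lit n m) →
                        ¬ T (isNegInput l) → evalLit γ l ≡ true → evalLit β l ≡ true
evalLit-positive-mono up agree (pos (inj₁ k)) _      γl = up k γl
evalLit-positive-mono up agree (neg (inj₁ k)) notNeg _  = ⊥-elim (notNeg _)
evalLit-positive-mono up agree (pos (inj₂ y)) _      γl = trans (sym (agree y)) γl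
evalLit-positive-mono up agree (neg (inj₂ y)) _      γl = trans (cong not (sym (agree y))) γl

removeQ-noNegInput : C ∈ removeQ φ → l ∈ C → ¬ T (isNegInput l)
removeQ-noNegInput {C = C} {φ = φ} C∈ l∈ t
  with ∈-filter⁻ (T? ∘ λ C → not (any isNegInput C)) {xs = φ} C∈
... | _ , noNeg = subst T (Equivalence.to T-not-≡ noNeg) (any⁺ isNegInput (lose l∈ t))

SatClause-removeQ-mono : InputsRaised γ β → AgreeOnAux γ β →
                         C ∈ removeQ φ → SatClause γ C → SatClause β C
SatClause-removeQ-mono {φ = φ} up agree C∈ s with find s
... | l , l∈ , γl =
  lose l∈ (evalLit-positive-mono up agree l (removeQ-noNegInput {φ = φ} C∈ l∈) γl)

removeQ-or-negInput : C ∈ φ → C ∈ removeQ φ ⊎ ∃ λ k → x̄ k ∈ C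
removeQ-or-negInput {C = C} C∈ with any isNegInput C in hasNeg
... | false =
  inj₁ (∈-filter⁺ (T? ∘ λ C → not (any isNegInput C)) C∈ (Equivalence.from T-not-≡ hasNeg))
... | true with find (any⁻ isNegInput C (Equivalence.from T-≡ hasNeg))
...   | neg (inj₁ k) , l∈ , _ = inj₂ (k , l∈)

∈-pair : {a b : Lit n m} → (l ≡ a ⊎ l ≡ b) ⇔ (l ∈ a ∷ b ∷ [])
∈-pair = mk⇔ (λ { (inj₁ refl) → here refl ; (inj₂ refl) → there (here refl) })
             (λ { (here refl) → inj₁ refl ; (there (here refl)) → inj₂ refl })

HasTwoLits-complement : HasTwoLits C → l ∈ C → ∃ λ e → e ≢ l × SameSet C (l ∷ e ∷ [])
HasTwoLits-complement (a , b , a≢b , mem) l∈ with Equivalence.to (mem _) l∈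
... | inj₁ refl = b , a≢b ∘ sym , λ l → ⇔.trans (mem l) ∈-pair
... | inj₂ refl = a , a≢b , λ l → ⇔.trans (mem l) (⇔.trans (mk⇔ swap swap) ∈-pair)

Q-member : C ∈ φ → x̄ k ∈ C → C ∈ Q φ k
Q-member {C = C} {k = k} C∈ x̄k∈ =
  ∈-filter⁺ (T? ∘ λ C → any (isX̄ k) C) C∈
    (any⁺ (isX̄ k) (lose x̄k∈ (Equivalence.from T-≡ (dec-true (k ≟ k) refl))))

evalLit-companion : OnlyInput k C → (e : Lit n m) → e ∈ C → e ≢ x̄ k →
                    β (inj₁ k) ≡ true → AgreeOnAux α β →
                    evalLit α e ≡ true → evalLit β e ≡ true
evalLit-companion only (pos (inj₁ k)) e∈ e≢ βk agree αe with only _ e∈ k refl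
... | refl = βk
evalLit-companion only (neg (inj₁ k)) e∈ e≢ βk agree αe with only _ e∈ k refl
... | refl = ⊥-elim (e≢ refl)
evalLit-companion only (pos (inj₂ y)) e∈ e≢ βk agree αe = trans (sym (agree y)) αe
evalLit-companion only (neg (inj₂ y)) e∈ e≢ βk agree αe = trans (cong not (sym (agree y))) αe

SatClause-Q : RegularForm φ → β (inj₁ k) ≡ true → AgreeOnAux α β →
              (∀ e → InL φ k e → evalLit α e ≡ true) →
              C ∈ φ → x̄ k ∈ C → SatClause β C
SatClause-Q {φ = φ} {k = k} {C = C} reg βk agree αL C∈ x̄k∈
  with proj₂ (reg k) C (Q-member {φ = φ} C∈ x̄k∈)
... | only , two with HasTwoLits-complement two x̄k∈
...   | e , e≢ , C≈ =
  lose e∈ (evalLit-companion only e e∈ e≢ βk agree (αL e (C , C∈ , C≈)))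
  where
  e∈ : e ∈ C
  e∈ = Equivalence.from (C≈ e) (there (here refl))

τ₂ : Fin n → Fin n → PartialAssignment n m
τ₂ i j (inj₁ k) = just (does (k ≟ i) ∨ does (k ≟ j))
τ₂ i j (inj₂ _) = nothing

module _ (i j : Fin n) (α : Assignment n m) where

  τ₂-left : (τ₂ i j ⊕ α) (inj₁ i) ≡ true
  τ₂-left = cong (_∨ does (i ≟ j)) (dec-true (i ≟ i) refl)

  τ₂-right : (τ₂ i j ⊕ α) (inj₁ j) ≡ true
  τ₂-right = trans (cong (does (j ≟ i) ∨_) (dec-true (j ≟ j) refl)) (∨-zeroʳ _)

  τ₂-other : k ≢ i → k ≢ j → (τ₂ i j ⊕ α) (inj₁ k) ≡ false
  τ₂-other {k = k} k≢i k≢j = cong₂ _∨_ (dec-false (k ≟ i) k≢i) (dec-false (k ≟ j) k≢j)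

  τ⊆τ₂ : InputsRaised (τ i ⊕ α) (τ₂ i j ⊕ α)
  τ⊆τ₂ k = cong (_∨ does (k ≟ j))

SatCNF-τ₂ : RegularForm φ → SatCNF α (restrict (removeQ φ) (τ i)) →
               (∀ e → InL φ i e → evalLit α e ≡ true) →
               (∀ e → InL φ j e → evalLit α e ≡ true) →
               SatCNF (τ₂ i j ⊕ α) φ
SatCNF-τ₂ {φ = φ} {α = α} {i = i} {j = j} reg satψ αLi αLj = tabulate sat
  where
  sat : C ∈ φ → SatClause (τ₂ i j ⊕ α) C
  sat C∈ with removeQ-or-negInput C∈
  ... | inj₁ C∈ψ = SatClause-removeQ-mono {φ = φ} (τ⊆τ₂ i j α) (λ _ → refl) C∈ψ
                     (lookup (SatCNF-restrict (removeQ φ) (τ i) satψ) C∈ψ)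
  ... | inj₂ (k , x̄k∈) with k ≟ i | k ≟ j
  ...   | yes refl | _        = SatClause-Q reg (τ₂-left i j α)  (λ _ → refl) αLi C∈ x̄k∈
  ...   | no _     | yes refl = SatClause-Q reg (τ₂-right i j α) (λ _ → refl) αLj C∈ x̄k∈
  ...   | no k≢i   | no k≢j   = lose x̄k∈ (cong not (τ₂-other i j α k≢i k≢j))

InL-true : {a b : Lit n m} → (∀ e → InL φ k e ⇔ (e ≡ a ⊎ e ≡ b)) →
           evalLit α a ≡ true → evalLit α b ≡ true →
           ∀ e → InL φ k e → evalLit α e ≡ true
InL-true L αa αb e h with Equivalence.to (L e) h
... | inj₁ refl = αa
... | inj₂ refl = αb

x̄-unsat : (α : Assignment n m) (k : Fin n) →
          α (inj₁ k) ≡ true → ¬ evalLit α (x̄ k) ≡ true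
x̄-unsat α k αk p = not-¬ (sym αk) (sym p)

lemma23 : {n m : ℕ} (φ : CNF n m) → GenPEncoding φ → RegularForm φ →
    (i j : Fin n) → ¬ (i ≡ j) →
    (ℓi1 ℓi2 ℓj1 ℓj2 : Lit n m) →
    ((e : Lit n m) → InL φ i e ⇔ (e ≡ ℓi1 ⊎ e ≡ ℓi2)) →
    ((e : Lit n m) → InL φ j e ⇔ (e ≡ ℓj1 ⊎ e ≡ ℓj2)) →
    ¬ Satisfiable (restrict (removeQ φ) (τ i) ++
      ((ℓi1 ∷ []) ∷ (ℓi2 ∷ []) ∷ (ℓj1 ∷ []) ∷ (ℓj2 ∷ []) ∷ []))
lemma23 φ enc reg i j i≢j ℓi1 ℓi2 ℓj1 ℓj2 Li Lj (α , sat)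
  with ++⁻ (restrict (removeQ φ) (τ i)) sat
... | satψ , si1 ∷ si2 ∷ sj1 ∷ sj2 ∷ [] =
  let β = τ₂ i j ⊕ α
      β⊨φ = SatCNF-τ₂ reg satψ (InL-true Li (singleton⁻ si1) (singleton⁻ si2))
                                  (InL-true Lj (singleton⁻ sj1) (singleton⁻ sj2))
  in All¬⇒¬Any (x̄-unsat β i (τ₂-left i j α) ∷ x̄-unsat β j (τ₂-right i j α) ∷ [])
               (GenPEncoding.amo enc i j i≢j β β⊨φ)
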